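{- Every matroid in $\mathcal{M}_v(\Phi_{Y_1})$ is a minor of a matroid in $\mathcal{M}(\Phi_{Y_0})$.
   Context: The class $\mathcal{M}_v(\Phi_{Y_1})$ is the class of all matroids isomorphic to the column matroid $M(A)$ of a matrix $A$ over $\mathrm{GF}(2)$ whose rows are indexed by $\{x_1,x_2\}\cup R$ for some finite set $R$, such that every column of $A$ is of one of the following two kinds: (a) its entries in rows $x_1,x_2$ are both $0$ and it has at most two nonzero entries in rows $R$; or (b) its entries in rows $(x_1,x_2)$ are $(1,0)$, $(0,1)$ or $(1,1)$ and it has at most one nonzero entry in rows $R$. The class $\mathcal{M}(\Phi_{Y_0})$ (matroids conforming to the template $\Phi_{Y_0}$; graft matroids) is the class of all matroids isomorphic to the column matroid of a binary matrix $[D\mid v]$, where every column of $D$ has at most two nonzero entries and $v$ is an arbitrary single column. -}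

module Defs where

open import Data.Nat using (ℕ; zero; suc; _+_; _≤_)
open import Data.Fin using (Fin; zero; suc; _≟_)
open import Data.Bool using (Bool; true; false; _∧_; _∨_; _xor_; if_then_else_)
open import Data.Product using (Σ; ∃; _×_; _,_)
open import Data.Sum using (_⊎_)
open import Relation.Nullary using (¬_)
open import Relation.Nullary.Decidable using (⌊_⌋)
open import Relation.Binary.PropositionalEquality using (_≡_)
open import Function using (_∘_)
open import Function.Bundles using (_↔_; Inverse)
open import Function.Definitions using (Injective)

FSubset : ℕ → Set
FSubset n = Fin n → Bool

_⊆_ : ∀ {n} → FSubset n → FSubset n → Set
S ⊆ T = ∀ j → S j ≡ true → T j ≡ true

_∪_ : ∀ {n} → FSubset n → FSubset n → FSubset n
(S ∪ T) j = S j ∨ T j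

⁅_⁆ : ∀ {n} → Fin n → FSubset n
⁅ y ⁆ j = ⌊ j ≟ y ⌋

count : ∀ {n} → (Fin n → Bool) → ℕ
count {zero}  f = 0
count {suc n} f = (if f zero then 1 else 0) + count (f ∘ suc)

anyF : ∀ {n} → (Fin n → Bool) → Bool
anyF {zero}  f = false
anyF {suc n} f = f zero ∨ anyF (f ∘ suc)

sum₂ : ∀ {n} → (Fin n → Bool) → Bool
sum₂ {zero}  f = false
sum₂ {suc n} f = f zero xor sum₂ (f ∘ suc)

image : ∀ {k m} → (Fin k → Fin m) → FSubset k → FSubset m
image e X y = anyF (λ x → X x ∧ ⌊ e x ≟ y ⌋)

-- Binary matrices (over GF(2) = Bool with xor, ∧): rows Fin r, columns Fin n.

Matrix₂ : ℕ → ℕ → Set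
Matrix₂ r n = Fin r → Fin n → Bool

colSum : ∀ {r n} → Matrix₂ r n → FSubset n → Fin r → Bool
colSum A T i = sum₂ (λ j → T j ∧ A i j)

LinIndep : ∀ {r n} → Matrix₂ r n → FSubset n → Set
LinIndep A S = ∀ T → T ⊆ S → (∀ i → colSum A T i ≡ false) → ∀ j → T j ≡ false

record SetSystem : Set₁ where
  field
    size  : ℕ
    Indep : FSubset size → Set
open SetSystem public

ColumnMatroid : ∀ {r n} → Matrix₂ r n → SetSystem
ColumnMatroid {r} {n} A = record { size = n ; Indep = LinIndep A }

_≅_ : SetSystem → SetSystem → Set
N ≅ M = Σ (Fin (size N) ↔ Fin (size M)) λ f →
          ∀ X → (Indep N X → Indep M (X ∘ Inverse.from f))
              × (Indep M (X ∘ Inverse.from f) → Indep N X)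

IsBasisOf : (M : SetSystem) → FSubset (size M) → FSubset (size M) → Set
IsBasisOf M B C = B ⊆ C × Indep M B
  × (∀ y → C y ≡ true → B y ≡ false → ¬ Indep M (B ∪ ⁅ y ⁆))

-- N is isomorphic to a minor M / C \ D of M: e identifies the ground set
-- of N with E(M) − (C ∪ D) (injective, image disjoint from C; everything
-- outside image(e) ∪ C is deleted); X is independent in M / C iff
-- X ∪ B is independent in M for some basis B of C.
IsMinorOf : SetSystem → SetSystem → Set
IsMinorOf N M =
  Σ (Fin (size N) → Fin (size M)) λ e →
  Σ (FSubset (size M)) λ C →
    Injective _≡_ _≡_ e
  × (∀ x → C (e x) ≡ false)
  × (∀ X → (Indep N X →
              Σ (FSubset (size M)) λ B → IsBasisOf M B C × Indep M (image e X ∪ B))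
         × ((Σ (FSubset (size M)) λ B → IsBasisOf M B C × Indep M (image e X ∪ B))
              → Indep N X))

-- The class M_v(Φ_{Y1}).  Rows Fin (2 + r): row 0 = x₁, row 1 = x₂,
-- rows suc (suc i) for i : Fin r form R.

Y1Column : ∀ {r n} → Matrix₂ (suc (suc r)) n → Fin n → Set
Y1Column {r} A j =
    (A zero j ≡ false × A (suc zero) j ≡ false
       × count (λ (i : Fin r) → A (suc (suc i)) j) ≤ 2)
  ⊎ ((A zero j ≡ true ⊎ A (suc zero) j ≡ true)
       × count (λ (i : Fin r) → A (suc (suc i)) j) ≤ 1)

InMvY1 : SetSystem → Set
InMvY1 N = Σ ℕ λ r → Σ ℕ λ n → Σ (Matrix₂ (suc (suc r)) n) λ A →
  (∀ j → Y1Column A j) × (N ≅ ColumnMatroid A)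

-- The class M(Φ_{Y0}): column matroids of [D | v], every column of D
-- with at most two nonzero entries, v arbitrary.  Here column 0 is v and
-- columns suc k form D.
InMY0 : SetSystem → Set
InMY0 M = Σ ℕ λ r → Σ ℕ λ n → Σ (Matrix₂ r (suc n)) λ A →
  (∀ (k : Fin n) → count (λ i → A i (suc k)) ≤ 2) × (M ≅ ColumnMatroid A)

-- Write the three nonzero patterns (1,0), (0,1), (1,1) of the rows x₁, x₂ as the unit vectors
-- e_a, e_b, e_c of three new rows a, b, c (rows 0, 1, 2 of D, followed by R).  Every column
-- then has at most two nonzero entries, and adjoining v = e_a + e_b + e_c gives a graft matrix
-- [v | D].  The linear map (w_a, w_b, w_c, w_R) ↦ (w_a + w_c, w_b + w_c, w_R) sends the columns
-- of D back to those of the original matrix and has kernel {0, v}, so contracting v recovers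
-- the original matroid.
module Submission where

open import Defs
open import Data.Bool using (Bool; true; false; not; _∧_; _∨_; _xor_)
open import Data.Bool.Properties
  using (∧-identityʳ; ∧-zeroʳ; ∨-identityʳ; ∨-zeroʳ; xor-same; xor-identityʳ;
         ∧-distribˡ-xor; xor-∧-commutativeRing)
open import Data.Empty using (⊥-elim)
open import Data.Fin using (Fin; zero; suc; _≟_)
open import Data.Fin.Properties using (suc-injective)
open import Data.Nat using (ℕ; suc; _≤_; s≤s)
open import Data.Product using (Σ; _×_; _,_; proj₁; proj₂)
open import Data.Sum using (_⊎_; inj₁; inj₂)
open import Data.Vec.Functional using (_∷_; tail)
open import Function using (_∘_; id)
open import Function.Bundles using (Inverse; Injection; _⇔_; mk⇔; Equivalence)
open import Function.Construct.Identity using (↔-id)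
open import Function.Definitions using (Injective)
open import Function.Properties.Inverse using (↔⇒↣)
open import Function.Construct.Composition using (_⇔-∘_)
open import Function.Construct.Symmetry using (⇔-sym)
open import Algebra.Bundles using (CommutativeRing)
open import Algebra.Properties.CommutativeSemigroup
  (CommutativeRing.+-commutativeSemigroup xor-∧-commutativeRing) using (interchange)
open import Relation.Nullary using (yes)
open import Relation.Nullary.Decidable using (⌊_⌋; isYes≗does; dec-true; dec-false)
open import Relation.Binary.PropositionalEquality
open ≡-Reasoning

sum₂-cong : ∀ {n} {f g : Fin n → Bool} → (∀ j → f j ≡ g j) → sum₂ f ≡ sum₂ g
sum₂-cong {ℕ.zero} _ = refl
sum₂-cong {suc n} f≗g = cong₂ _xor_ (f≗g zero) (sum₂-cong (f≗g ∘ suc))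

sum₂-xor : ∀ {n} (f g : Fin n → Bool) → sum₂ f xor sum₂ g ≡ sum₂ (λ j → f j xor g j)
sum₂-xor {ℕ.zero} f g = refl
sum₂-xor {suc n} f g = begin
  (f zero xor sum₂ (f ∘ suc)) xor (g zero xor sum₂ (g ∘ suc))
    ≡⟨ interchange (f zero) (sum₂ (f ∘ suc)) (g zero) (sum₂ (g ∘ suc)) ⟩
  (f zero xor g zero) xor (sum₂ (f ∘ suc) xor sum₂ (g ∘ suc))
    ≡⟨ cong ((f zero xor g zero) xor_) (sum₂-xor (f ∘ suc) (g ∘ suc)) ⟩
  (f zero xor g zero) xor sum₂ (λ j → f (suc j) xor g (suc j)) ∎

sum₂-zero : ∀ {n} {f : Fin n → Bool} → (∀ j → f j ≡ false) → sum₂ f ≡ false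
sum₂-zero {ℕ.zero} _ = refl
sum₂-zero {suc n} f≡0 rewrite f≡0 zero = sum₂-zero (f≡0 ∘ suc)

colSum-xor : ∀ {r n} (A : Matrix₂ r n) T i i' →
             colSum A T i xor colSum A T i' ≡ sum₂ (λ j → T j ∧ (A i j xor A i' j))
colSum-xor A T i i' = trans (sum₂-xor (λ j → T j ∧ A i j) (λ j → T j ∧ A i' j))
  (sum₂-cong λ j → sym (∧-distribˡ-xor (T j) (A i j) (A i' j)))

anyF-zero : ∀ {n} {f : Fin n → Bool} → (∀ j → f j ≡ false) → anyF f ≡ false
anyF-zero {ℕ.zero} _ = refl
anyF-zero {suc n} f≡0 rewrite f≡0 zero = anyF-zero (f≡0 ∘ suc)

anyF-single : ∀ {n} {f : Fin n → Bool} i → (∀ j → j ≢ i → f j ≡ false) → anyF f ≡ f i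
anyF-single {f = f} zero others =
  trans (cong (f zero ∨_) (anyF-zero λ j → others (suc j) λ ())) (∨-identityʳ (f zero))
anyF-single (suc i) others rewrite others zero (λ ()) =
  anyF-single i λ j j≢i → others (suc j) (j≢i ∘ suc-injective)

image-injective : ∀ {k m} {e : Fin k → Fin m} → Injective _≡_ _≡_ e →
                  ∀ X x → image e X (e x) ≡ X x
image-injective {e = e} e-inj X x = begin
  image e X (e x)          ≡⟨ anyF-single x miss ⟩
  X x ∧ ⌊ e x ≟ e x ⌋      ≡⟨ cong (X x ∧_) (trans (isYes≗does _) (dec-true (e x ≟ e x) refl)) ⟩
  X x ∧ true               ≡⟨ ∧-identityʳ (X x) ⟩
  X x                      ∎
  where
  miss : ∀ x' → x' ≢ x → X x' ∧ ⌊ e x' ≟ e x ⌋ ≡ false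
  miss x' x'≢x = trans (cong (X x' ∧_) (trans (isYes≗does _) (dec-false (e x' ≟ e x) (x'≢x ∘ e-inj))))
                       (∧-zeroʳ (X x'))

∪-⊆ : ∀ {n} {S T U : FSubset n} → S ⊆ U → T ⊆ U → (S ∪ T) ⊆ U
∪-⊆ {S = S} S⊆U T⊆U j p with S j in Sj
... | true  = S⊆U j Sj
... | false = T⊆U j p

∪-monoʳ : ∀ {n} (Y : FSubset n) {S T : FSubset n} → S ⊆ T → (Y ∪ S) ⊆ (Y ∪ T)
∪-monoʳ Y S⊆T j p with Y j
... | true  = refl
... | false = S⊆T j p

⁅⁆-⊆ : ∀ {n} {C : FSubset n} {y} → C y ≡ true → ⁅ y ⁆ ⊆ C
⁅⁆-⊆ {y = y} Cy j p with j ≟ y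
⁅⁆-⊆ Cy j refl | yes refl = Cy

SumsToZero : ∀ {r n} → Matrix₂ r n → FSubset n → Set
SumsToZero A T = ∀ i → colSum A T i ≡ false

LinIndep-anti : ∀ {r n} (A : Matrix₂ r n) {S S'} → S ⊆ S' → LinIndep A S' → LinIndep A S
LinIndep-anti A S⊆S' S'-ind T T⊆S = S'-ind T (λ j → S⊆S' j ∘ T⊆S j)

LinIndep-cong : ∀ {r n} (A : Matrix₂ r n) {S S'} → (∀ j → S j ≡ S' j) → LinIndep A S ⇔ LinIndep A S'
LinIndep-cong A S≗S' =
  mk⇔ (LinIndep-anti A λ j → trans (S≗S' j)) (LinIndep-anti A λ j → trans (sym (S≗S' j)))

nonzero-column-independent : ∀ {r n} (A : Matrix₂ r (suc n)) i → A i zero ≡ true →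
                             LinIndep A ⁅ zero ⁆
nonzero-column-independent A i Aᵢ₀ T T⊆ T-zero = λ { zero → T₀≡0 ; (suc j) → tail≡0 j }
  where
  tail≡0 : ∀ j → T (suc j) ≡ false
  tail≡0 j with T (suc j) in Tj
  ... | false = refl
  ... | true  = sym (T⊆ (suc j) Tj)
  T₀≡0 : T zero ≡ false
  T₀≡0 = begin
    T zero                                                ≡⟨ sym (∧-identityʳ (T zero)) ⟩
    T zero ∧ true                                         ≡⟨ cong (T zero ∧_) (sym Aᵢ₀) ⟩
    T zero ∧ A i zero                                     ≡⟨ sym (xor-identityʳ _) ⟩
    (T zero ∧ A i zero) xor false
      ≡⟨ cong ((T zero ∧ A i zero) xor_) (sym (sum₂-zero λ j → cong (_∧ A i (suc j)) (tail≡0 j))) ⟩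
    colSum A T i                                          ≡⟨ T-zero i ⟩
    false                                                 ∎

-- Contracting the first column v of B: the dependencies of B are exactly the lifts of those of A.
LinIndep-contract : ∀ {r s n} (B : Matrix₂ s (suc n)) (A : Matrix₂ r n) →
  LinIndep B ⁅ zero ⁆ →
  (∀ T → SumsToZero B T → SumsToZero A (tail T)) →
  (∀ T → SumsToZero A T → Σ Bool λ b → SumsToZero B (b ∷ T)) →
  ∀ X → LinIndep A X ⇔ LinIndep B (true ∷ X)
LinIndep-contract B A v-indep restrict lift X = mk⇔ contract-to contract-from
  where
  contract-to : LinIndep A X → LinIndep B (true ∷ X)
  contract-to X-indep T T⊆ T-zero = v-indep T T⊆⁅0⁆ T-zero
    where
    tail≡0 : ∀ j → T (suc j) ≡ false
    tail≡0 = X-indep (tail T) (T⊆ ∘ suc) (restrict T T-zero)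
    T⊆⁅0⁆ : T ⊆ ⁅ zero ⁆
    T⊆⁅0⁆ zero    _ = refl
    T⊆⁅0⁆ (suc j) p = trans (sym (tail≡0 j)) p
  contract-from : LinIndep B (true ∷ X) → LinIndep A X
  contract-from vX-indep T T⊆X T-zero j with lift T T-zero
  ... | b , bT-zero = vX-indep (b ∷ T) bT⊆ bT-zero (suc j)
    where
    bT⊆ : (b ∷ T) ⊆ (true ∷ X)
    bT⊆ zero    _ = refl
    bT⊆ (suc k) p = T⊆X k p

IsBasisOf-refl : (M : SetSystem) {C : FSubset (size M)} → Indep M C → IsBasisOf M C C
IsBasisOf-refl M C-indep = (λ _ → id) , C-indep , λ y Cy Cy≡0 _ → true≢false (trans (sym Cy) Cy≡0)
  where
  true≢false : true ≢ false
  true≢false ()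

basis-of-independent : ∀ {r n} (A : Matrix₂ r n) {B C} → LinIndep A C →
                       IsBasisOf (ColumnMatroid A) B C → C ⊆ B
basis-of-independent A {B} C-indep (B⊆C , _ , maximal) y Cy with B y in By
... | true  = refl
... | false = ⊥-elim (maximal y Cy By (LinIndep-anti A (∪-⊆ B⊆C (⁅⁆-⊆ Cy)) C-indep))

contract-independent : ∀ {r n} (A : Matrix₂ r n) {C} → LinIndep A C → ∀ Y →
  (Σ (FSubset n) λ B → IsBasisOf (ColumnMatroid A) B C × LinIndep A (Y ∪ B)) ⇔ LinIndep A (Y ∪ C)
contract-independent A C-indep Y = mk⇔
  (λ (B , B-basis , YB-indep) →
     LinIndep-anti A (∪-monoʳ Y (basis-of-independent A C-indep B-basis)) YB-indep)
  (λ YC-indep → _ , IsBasisOf-refl (ColumnMatroid A) C-indep , YC-indep)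

IsMinorOf-contract : ∀ {N r s n} {A : Matrix₂ r n} (B : Matrix₂ s (suc n)) →
  N ≅ ColumnMatroid A → LinIndep B ⁅ zero ⁆ →
  (∀ X → LinIndep A X ⇔ LinIndep B (true ∷ X)) → IsMinorOf N (ColumnMatroid B)
IsMinorOf-contract {N} {n = n} {A} B (f , N≅A) v-indep A⇔B =
  embed , ⁅ zero ⁆ , embed-injective , (λ _ → refl) ,
  λ X → Equivalence.to (minor⇔ X) , Equivalence.from (minor⇔ X)
  where
  open Inverse f
  embed : Fin (size N) → Fin (suc n)
  embed = suc ∘ to
  embed-injective : Injective _≡_ _≡_ embed
  embed-injective = Injection.injective (↔⇒↣ f) ∘ suc-injective
  image-embed : ∀ X j → (true ∷ X ∘ from) j ≡ (image embed X ∪ ⁅ zero ⁆) j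
  image-embed X zero    = sym (∨-zeroʳ _)
  image-embed X (suc k) = begin
    X (from k)                           ≡⟨ sym (image-injective embed-injective X (from k)) ⟩
    image embed X (suc (to (from k)))    ≡⟨ cong (image embed X ∘ suc) (strictlyInverseˡ k) ⟩
    image embed X (suc k)                ≡⟨ sym (∨-identityʳ _) ⟩
    image embed X (suc k) ∨ false        ∎
  minor⇔ : ∀ X → Indep N X ⇔
    (Σ (FSubset (suc n)) λ C → IsBasisOf (ColumnMatroid B) C ⁅ zero ⁆ × LinIndep B (image embed X ∪ C))
  minor⇔ X = ⇔-sym (contract-independent B v-indep (image embed X))
    ⇔-∘ (LinIndep-cong B (image-embed X) ⇔-∘ (A⇔B (X ∘ from) ⇔-∘ mk⇔ (proj₁ (N≅A X)) (proj₂ (N≅A X))))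

graft : ∀ {r} → Fin (suc (suc (suc r))) → Bool
graft zero                   = true
graft (suc zero)             = true
graft (suc (suc zero))       = true
graft (suc (suc (suc _)))    = false

collapse : ∀ {r} → (Fin (suc (suc (suc r))) → Bool) → Fin (suc (suc r)) → Bool
collapse w zero          = w zero xor w (suc (suc zero))
collapse w (suc zero)    = w (suc zero) xor w (suc (suc zero))
collapse w (suc (suc i)) = w (suc (suc (suc i)))

collapse-graft : ∀ {r} i → collapse (graft {r}) i ≡ false
collapse-graft zero          = refl
collapse-graft (suc zero)    = refl
collapse-graft (suc (suc i)) = refl

collapse-colSum : ∀ {r m} (B : Matrix₂ (suc (suc (suc r))) m) T i →
  collapse (colSum B T) i ≡ colSum (λ i' j → collapse (λ k → B k j) i') T i
collapse-colSum B T zero          = colSum-xor B T zero (suc (suc zero))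
collapse-colSum B T (suc zero)    = colSum-xor B T (suc zero) (suc (suc zero))
collapse-colSum B T (suc (suc i)) = refl

collapse-zero : ∀ {r} (w : Fin (suc (suc (suc r))) → Bool) → (∀ k → w k ≡ false) →
                ∀ i → collapse w i ≡ false
collapse-zero w w≡0 zero          rewrite w≡0 zero       | w≡0 (suc (suc zero)) = refl
collapse-zero w w≡0 (suc zero)    rewrite w≡0 (suc zero) | w≡0 (suc (suc zero)) = refl
collapse-zero w w≡0 (suc (suc i)) = w≡0 (suc (suc (suc i)))

collapse-kernel : ∀ {r} (w : Fin (suc (suc (suc r))) → Bool) → (∀ i → collapse w i ≡ false) →
                  (∀ k → w k ≡ false) ⊎ (∀ k → w k ≡ graft k)
collapse-kernel w w↦0
  with w zero in w₀ | w (suc zero) in w₁ | w (suc (suc zero)) in w₂ | w↦0 zero | w↦0 (suc zero)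
... | false | false | false | _  | _  = inj₁ λ
  { zero → w₀ ; (suc zero) → w₁ ; (suc (suc zero)) → w₂ ; (suc (suc (suc i))) → w↦0 (suc (suc i)) }
... | true  | true  | true  | _  | _  = inj₂ λ
  { zero → w₀ ; (suc zero) → w₁ ; (suc (suc zero)) → w₂ ; (suc (suc (suc i))) → w↦0 (suc (suc i)) }
... | false | _     | true  | () | _
... | true  | _     | false | () | _
... | false | true  | false | _  | ()
... | true  | false | true  | _  | ()

module Graft {r n} (A : Matrix₂ (suc (suc r)) n) where

  D : Matrix₂ (suc (suc (suc r))) n
  D zero                j = A zero j ∧ not (A (suc zero) j)
  D (suc zero)          j = not (A zero j) ∧ A (suc zero) j
  D (suc (suc zero))    j = A zero j ∧ A (suc zero) j
  D (suc (suc (suc i))) j = A (suc (suc i)) j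

  graftMatrix : Matrix₂ (suc (suc (suc r))) (suc n)
  graftMatrix i = graft i ∷ D i

  collapse-D : ∀ j i → collapse (λ k → D k j) i ≡ A i j
  collapse-D j (suc (suc i)) = refl
  collapse-D j zero       with A zero j | A (suc zero) j
  ... | false | false = refl
  ... | false | true  = refl
  ... | true  | false = refl
  ... | true  | true  = refl
  collapse-D j (suc zero) with A zero j | A (suc zero) j
  ... | false | false = refl
  ... | false | true  = refl
  ... | true  | false = refl
  ... | true  | true  = refl

  collapse-graftMatrix : ∀ T i → collapse (colSum graftMatrix T) i ≡ colSum A (tail T) i
  collapse-graftMatrix T i = begin
    collapse (colSum graftMatrix T) i
      ≡⟨ collapse-colSum graftMatrix T i ⟩
    (T zero ∧ collapse graft i) xor sum₂ (λ j → T (suc j) ∧ collapse (λ k → D k j) i)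
      ≡⟨ cong₂ _xor_ (trans (cong (T zero ∧_) (collapse-graft i)) (∧-zeroʳ (T zero)))
                     (sum₂-cong λ j → cong (T (suc j) ∧_) (collapse-D j i)) ⟩
    colSum A (tail T) i
      ∎

  graft-independent : LinIndep graftMatrix ⁅ zero ⁆
  graft-independent = nonzero-column-independent graftMatrix zero refl

  graftMatrix-contract : ∀ X → LinIndep A X ⇔ LinIndep graftMatrix (true ∷ X)
  graftMatrix-contract = LinIndep-contract graftMatrix A graft-independent restrict lift
    where
    restrict : ∀ T → SumsToZero graftMatrix T → SumsToZero A (tail T)
    restrict T T-zero i = trans (sym (collapse-graftMatrix T i)) (collapse-zero _ T-zero i)
    lift : ∀ T → SumsToZero A T → Σ Bool λ b → SumsToZero graftMatrix (b ∷ T)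
    lift T T-zero with collapse-kernel (colSum graftMatrix (false ∷ T))
                         (λ i → trans (collapse-graftMatrix (false ∷ T) i) (T-zero i))
    ... | inj₁ w≡0     = false , w≡0
    ... | inj₂ w≡graft = true , λ i → trans (cong (graft i xor_) (w≡graft i)) (xor-same (graft i))

  D-column-count : ∀ k → Y1Column A k → count (λ i → D i k) ≤ 2
  D-column-count k y1 with A zero k | A (suc zero) k
  D-column-count k (inj₁ (refl , refl , c)) | false | false = c
  D-column-count k (inj₂ (inj₁ () , _))     | false | false
  D-column-count k (inj₂ (inj₂ () , _))     | false | false
  D-column-count k (inj₁ (_ , () , _))      | false | true
  D-column-count k (inj₂ (_ , c))           | false | true  = s≤s c
  D-column-count k (inj₁ (() , _ , _))      | true  | _
  D-column-count k (inj₂ (_ , c))           | true  | false = s≤s c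
  D-column-count k (inj₂ (_ , c))           | true  | true  = s≤s c

lemma4p7 : (N : SetSystem) → InMvY1 N → Σ SetSystem λ M → InMY0 M × IsMinorOf N M
lemma4p7 N (r , n , A , Y1-columns , N≅A) =
  ColumnMatroid graftMatrix ,
  (suc (suc (suc r)) , n , graftMatrix , (λ k → D-column-count k (Y1-columns k)) ,
   ↔-id _ , λ _ → id , id) ,
  IsMinorOf-contract graftMatrix N≅A graft-independent graftMatrix-contract
  where open Graft A
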